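{- The variety of Boolean algebras (equivalently, classical propositional logic, with formulas identified up to logical equivalence) has unitary e-generalization type.
   Context: Symbolic e-generalization for a variety $\mathsf V$: a problem is a finite multiset $\{t_1,\ldots,t_m\}$ of terms (elements of a finitely generated free algebra of $\mathsf V$); a solution is a term $s$ such that there are substitutions $\sigma_k$ with $\mathsf V\models\sigma_k(s)\approx t_k$ for all $k$; $s\preceq u$ iff $\sigma(u)=s$ (in $\mathsf V$) for some substitution $\sigma$. In the poset of solutions modulo equal generality, a minimal complete set is a set of pairwise incomparable solutions such that every solution lies above one of them. A problem is unitary if there is such a set of cardinality 1 (finitary, infinitary, nullary if finite $>1$, infinite, none). $\mathsf V$ has unitary type if every problem (with any finite number of terms) is unitary. -}

module Defs where

open import Data.Nat using (ℕ; suc)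
open import Data.Fin using (Fin)
open import Data.Bool using (Bool; true; false; not; _∧_; _∨_)
open import Data.Product using (Σ; ∃; _×_; _,_)
open import Relation.Binary.PropositionalEquality using (_≡_; _≢_)
open import Relation.Nullary using (¬_)

data Form (n : ℕ) : Set where
  var  : Fin n → Form n
  ⊤ᶠ   : Form n
  ⊥ᶠ   : Form n
  ¬ᶠ_  : Form n → Form n
  _∧ᶠ_ : Form n → Form n → Form n
  _∨ᶠ_ : Form n → Form n → Form n

eval : ∀ {n} → (Fin n → Bool) → Form n → Bool
eval v (var i)  = v i
eval v ⊤ᶠ       = true
eval v ⊥ᶠ       = false
eval v (¬ᶠ φ)   = not (eval v φ)
eval v (φ ∧ᶠ ψ) = eval v φ ∧ eval v ψ
eval v (φ ∨ᶠ ψ) = eval v φ ∨ eval v ψ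

-- Equality in the free Boolean algebra: BA ⊨ φ ≈ ψ, i.e. logical equivalence
-- (the two-element algebra generates the variety).
_≈_ : ∀ {n} → Form n → Form n → Set
φ ≈ ψ = ∀ v → eval v φ ≡ eval v ψ

Subst : ℕ → ℕ → Set
Subst n m = Fin n → Form m

_[_] : ∀ {n m} → Form n → Subst n m → Form m
var i    [ σ ] = σ i
⊤ᶠ       [ σ ] = ⊤ᶠ
⊥ᶠ       [ σ ] = ⊥ᶠ
(¬ᶠ φ)   [ σ ] = ¬ᶠ (φ [ σ ])
(φ ∧ᶠ ψ) [ σ ] = (φ [ σ ]) ∧ᶠ (ψ [ σ ])
(φ ∨ᶠ ψ) [ σ ] = (φ [ σ ]) ∨ᶠ (ψ [ σ ])

Term : Set
Term = Σ ℕ Form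

_≼_ : Term → Term → Set
(n , s) ≼ (m , u) = Σ (Subst m n) λ σ → (u [ σ ]) ≈ s

IsSolution : ∀ {p k} → (Fin k → Form p) → Term → Set
IsSolution {p} t (n , s) = ∀ i → Σ (Subst n p) λ σ → (s [ σ ]) ≈ t i

IsMinimalCompleteSet : ∀ {p k c} → (Fin k → Form p) → (Fin c → Term) → Set
IsMinimalCompleteSet t S =
  (∀ j → IsSolution t (S j))
  × (∀ i j → i ≢ j → ¬ (S i ≼ S j))
  × (∀ u → IsSolution t u → ∃ λ j → S j ≼ u)

Unitary : ∀ {p k} → (Fin k → Form p) → Set
Unitary t = Σ (Fin 1 → Term) λ S → IsMinimalCompleteSet t S

UnitaryType : Set
UnitaryType = ∀ (p m : ℕ) (t : Fin (suc m) → Form p) → Unitary t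

module Submission where

-- The least general generalization of t₀,…,tₘ (terms over p variables) is the
-- case distinction  "if c₀ then t₀ else if c₁ then t₁ … else tₘ"  over m fresh
-- selector variables c₀,…,c_{m-1} and the p old ones.  Setting the selectors to
-- the one-hot pattern of i instantiates it to tᵢ.  Conversely, if u σᵢ = tᵢ for
-- every i, substitute for each variable z of u the case distinction of the σᵢ(z):
-- substitution commutes with case distinction (under any valuation the selectors
-- choose the same branch on both sides), so u becomes the case distinction of the
-- u σᵢ = tᵢ.

open import Defs
open import Data.Nat using (ℕ; zero; suc; _+_)
open import Data.Fin using (Fin; zero; suc; _↑ˡ_; _↑ʳ_; splitAt)
open import Data.Fin.Properties using (splitAt-↑ˡ; splitAt-↑ʳ)
open import Data.Bool using (Bool; true; false; not; _∧_; _∨_; if_then_else_)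
open import Data.Product using (_,_; proj₁; proj₂)
open import Data.Sum using ([_,_]′)
open import Function using (_∘_)
open import Relation.Binary.Bundles using (Setoid)
open import Relation.Binary.PropositionalEquality
  using (_≡_; refl; sym; trans; cong; cong₂; module ≡-Reasoning)
import Relation.Binary.Reasoning.Setoid as SetoidReasoning

private
  variable
    n m k p : ℕ

≈-setoid : ℕ → Setoid _ _
≈-setoid n = record
  { Carrier       = Form n
  ; _≈_           = _≈_
  ; isEquivalence = record
    { refl  = λ _ → refl
    ; sym   = λ e v → sym (e v)
    ; trans = λ e f v → trans (e v) (f v)
    }
  }

_⨾_ : Subst n m → Subst m k → Subst n k
(σ ⨾ ρ) x = σ x [ ρ ]

[]-⨾ : ∀ (σ : Subst n m) (ρ : Subst m k) φ → φ [ σ ⨾ ρ ] ≡ (φ [ σ ]) [ ρ ]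
[]-⨾ σ ρ (var i)  = refl
[]-⨾ σ ρ ⊤ᶠ       = refl
[]-⨾ σ ρ ⊥ᶠ       = refl
[]-⨾ σ ρ (¬ᶠ φ)   = cong ¬ᶠ_ ([]-⨾ σ ρ φ)
[]-⨾ σ ρ (φ ∧ᶠ ψ) = cong₂ _∧ᶠ_ ([]-⨾ σ ρ φ) ([]-⨾ σ ρ ψ)
[]-⨾ σ ρ (φ ∨ᶠ ψ) = cong₂ _∨ᶠ_ ([]-⨾ σ ρ φ) ([]-⨾ σ ρ ψ)

eval-cong : ∀ {v w : Fin n → Bool} → (∀ x → v x ≡ w x) → ∀ φ → eval v φ ≡ eval w φ
eval-cong e (var i)  = e i
eval-cong e ⊤ᶠ       = refl
eval-cong e ⊥ᶠ       = refl
eval-cong e (¬ᶠ φ)   = cong not (eval-cong e φ)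
eval-cong e (φ ∧ᶠ ψ) = cong₂ _∧_ (eval-cong e φ) (eval-cong e ψ)
eval-cong e (φ ∨ᶠ ψ) = cong₂ _∨_ (eval-cong e φ) (eval-cong e ψ)

eval-[] : ∀ (v : Fin m → Bool) (σ : Subst n m) φ → eval v (φ [ σ ]) ≡ eval (eval v ∘ σ) φ
eval-[] v σ (var i)  = refl
eval-[] v σ ⊤ᶠ       = refl
eval-[] v σ ⊥ᶠ       = refl
eval-[] v σ (¬ᶠ φ)   = cong not (eval-[] v σ φ)
eval-[] v σ (φ ∧ᶠ ψ) = cong₂ _∧_ (eval-[] v σ φ) (eval-[] v σ ψ)
eval-[] v σ (φ ∨ᶠ ψ) = cong₂ _∨_ (eval-[] v σ φ) (eval-[] v σ ψ)

[]-resp-≈ : ∀ (ρ : Subst n m) {φ ψ} → φ ≈ ψ → (φ [ ρ ]) ≈ (ψ [ ρ ])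
[]-resp-≈ ρ {φ} {ψ} φ≈ψ v = begin
  eval v (φ [ ρ ])    ≡⟨ eval-[] v ρ φ ⟩
  eval (eval v ∘ ρ) φ ≡⟨ φ≈ψ (eval v ∘ ρ) ⟩
  eval (eval v ∘ ρ) ψ ≡⟨ eval-[] v ρ ψ ⟨
  eval v (ψ [ ρ ])    ∎
  where open ≡-Reasoning

firstTrue : (Fin m → Bool) → Fin (suc m)
firstTrue {zero}  b = zero
firstTrue {suc m} b = if b zero then zero else suc (firstTrue (b ∘ suc))

firstTrue-cong : ∀ {b c : Fin m → Bool} → (∀ j → b j ≡ c j) → firstTrue b ≡ firstTrue c
firstTrue-cong {zero}  e = refl
firstTrue-cong {suc m} e rewrite e zero | firstTrue-cong (e ∘ suc) = refl

-- oneHot i has its only true entry at i; for the last index i = m it is all false.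
oneHot : Fin (suc m) → Fin m → Bool
oneHot zero    j       = true
oneHot (suc i) zero    = false
oneHot (suc i) (suc j) = oneHot i j

firstTrue-oneHot : ∀ (i : Fin (suc m)) → firstTrue (oneHot i) ≡ i
firstTrue-oneHot {zero}  zero    = refl
firstTrue-oneHot {suc m} zero    = refl
firstTrue-oneHot {suc m} (suc i) = cong suc (firstTrue-oneHot i)

cases : (Fin m → Form n) → (Fin (suc m) → Form n) → Form n
cases {zero}  c f = f zero
cases {suc m} c f = (c zero ∧ᶠ f zero) ∨ᶠ ((¬ᶠ c zero) ∧ᶠ cases (c ∘ suc) (f ∘ suc))

eval-cases : ∀ (v : Fin n → Bool) (c : Fin m → Form n) f →
             eval v (cases c f) ≡ eval v (f (firstTrue (eval v ∘ c)))
eval-cases {m = zero}  v c f = refl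
eval-cases {m = suc m} v c f with eval v (c zero)
... | true  with eval v (f zero)
...   | true  = refl
...   | false = refl
eval-cases {m = suc m} v c f | false = eval-cases v (c ∘ suc) (f ∘ suc)

cases-cong : ∀ (c : Fin m → Form n) {f g} → (∀ i → f i ≈ g i) → cases c f ≈ cases c g
cases-cong c {f} {g} f≈g v = begin
  eval v (cases c f)                      ≡⟨ eval-cases v c f ⟩
  eval v (f (firstTrue (eval v ∘ c)))     ≡⟨ f≈g _ v ⟩
  eval v (g (firstTrue (eval v ∘ c)))     ≡⟨ eval-cases v c g ⟨
  eval v (cases c g)                      ∎
  where open ≡-Reasoning

[]-cases : ∀ (c : Fin m → Form k) (σ : Fin (suc m) → Subst n k) φ →
           (φ [ (λ z → cases c (λ i → σ i z)) ]) ≈ cases c (λ i → φ [ σ i ])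
[]-cases c σ φ v = begin
  eval v (φ [ (λ z → cases c (λ i → σ i z)) ]) ≡⟨ eval-[] v _ φ ⟩
  eval (λ z → eval v (cases c (λ i → σ i z))) φ ≡⟨ eval-cong (λ z → eval-cases v c (λ i → σ i z)) φ ⟩
  eval (eval v ∘ σ I) φ                        ≡⟨ eval-[] v (σ I) φ ⟨
  eval v (φ [ σ I ])                           ≡⟨ eval-cases v c (λ i → φ [ σ i ]) ⟨
  eval v (cases c (λ i → φ [ σ i ]))           ∎
  where
  open ≡-Reasoning
  I = firstTrue (eval v ∘ c)

selector : Fin m → Form (m + p)
selector {p = p} j = var (j ↑ˡ p)

weaken : Subst p (m + p)
weaken {m = m} j = var (m ↑ʳ j)

lgg : (Fin (suc m) → Form p) → Form (m + p)
lgg t = cases selector (λ i → t i [ weaken ])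

bool : Bool → Form n
bool true  = ⊤ᶠ
bool false = ⊥ᶠ

eval-bool : ∀ (v : Fin n → Bool) b → eval v (bool b) ≡ b
eval-bool v true  = refl
eval-bool v false = refl

specialise : Fin (suc m) → Subst (m + p) p
specialise {m} i x = [ bool ∘ oneHot i , var ]′ (splitAt m x)

lgg-specialise : ∀ (t : Fin (suc m) → Form p) i → (lgg t [ specialise i ]) ≈ t i
lgg-specialise {m} {p} t i v = begin
  eval v (lgg t [ specialise i ])                  ≡⟨ eval-[] v (specialise i) (lgg t) ⟩
  eval w (lgg t)                                   ≡⟨ eval-cases w selector (λ j → t j [ weaken ]) ⟩
  eval w (t (firstTrue (eval w ∘ selector)) [ weaken ])
    ≡⟨ cong (λ j → eval w (t j [ weaken ])) picksBranch ⟩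
  eval w (t i [ weaken ])                          ≡⟨ eval-[] w weaken (t i) ⟩
  eval (eval w ∘ weaken) (t i)
    ≡⟨ eval-cong (λ j → cong (eval v ∘ [ _ , var ]′) (splitAt-↑ʳ m p j)) (t i) ⟩
  eval v (t i)                                     ∎
  where
  open ≡-Reasoning
  w = eval v ∘ specialise i
  picksBranch : firstTrue (eval w ∘ selector) ≡ i
  picksBranch = trans
    (firstTrue-cong λ j → trans (cong (eval v ∘ [ bool ∘ oneHot i , var ]′) (splitAt-↑ˡ m j p))
                                (eval-bool v (oneHot i j)))
    (firstTrue-oneHot i)

lgg-isSolution : ∀ (t : Fin (suc m) → Form p) → IsSolution t (m + p , lgg t)
lgg-isSolution t i = specialise i , lgg-specialise t i

lgg-least : ∀ (t : Fin (suc m) → Form p) u → IsSolution t u → (m + p , lgg t) ≼ u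
lgg-least {m} {p} t (n , φ) sol = τ , (begin
  φ [ τ ]                                ≈⟨ []-cases selector σ′ φ ⟩
  cases selector (λ i → φ [ σ′ i ])      ≈⟨ cases-cong selector instanceOfTᵢ ⟩
  lgg t                                  ∎)
  where
  open SetoidReasoning (≈-setoid (m + p))
  σ′ : Fin (suc m) → Subst n (m + p)
  σ′ i = proj₁ (sol i) ⨾ weaken
  τ : Subst n (m + p)
  τ z = cases selector (λ i → σ′ i z)
  instanceOfTᵢ : ∀ i → (φ [ σ′ i ]) ≈ (t i [ weaken ])
  instanceOfTᵢ i v = trans (cong (eval v) ([]-⨾ (proj₁ (sol i)) weaken φ))
                           ([]-resp-≈ weaken {φ [ proj₁ (sol i) ]} {t i} (proj₂ (sol i)) v)

theorem5p1 : UnitaryType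
theorem5p1 p m t = (λ _ → m + p , lgg t)
                 , (λ _ → lgg-isSolution t)
                 , (λ { zero zero i≢j _ → i≢j refl })
                 , (λ u sol → zero , lgg-least t u sol)
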